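{- Consider basketball walks, i.e. walks with steps $-2,-1,+1,+2$. For integers $j,k\ge0$ let $G_{j,k}(z)$ be the generating function ($z$ marking length) of walks from altitude $j$ to altitude $k$ all of whose points other than the first and the last have altitude strictly greater than $0$. Let $u_1(z),u_2(z)$ be the two small roots of $1-zP(u)=0$ with $P(u)=u^{ -2}+u^{ -1}+u+u^2$ (the roots with $\lim_{z\to0}u_i(z)=0$), and for an integer $m\ge0$ put $h_m=\frac{u_1^{m+1}-u_2^{m+1}}{u_1-u_2}$. Then for $k>0$, $$G_{0,k}(z)=\frac{u_1^{k+1}(z)-u_2^{k+1}(z)}{u_1(z)-u_2(z)},$$ and for $j,k>0$, $$G_{j,k}(z)=-\frac{u_1(z)u_2(z)}{z}\sum_{i=1}^{\min(j,k)}h_{j-i}\,h_{k-i}.$$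
   Context: A walk with steps $-2,-1,+1,+2$ moves one unit right and the indicated number of units vertically at each step. -}

module Defs where

open import Data.Nat as ℕ using (ℕ; zero; suc; _⊓_)
open import Data.Integer as ℤ using (ℤ; +_; -[1+_])
open import Data.Integer.Properties as ℤP using ()
open import Data.Rational as ℚ using (ℚ; 0ℚ; 1ℚ)
open import Data.Fin using (Fin)
open import Data.Vec using (Vec; []; _∷_)
open import Data.List using (List; []; _∷_; _++_; map; concatMap)
open import Data.Bool using (Bool; true; false; _∧_; if_then_else_)
open import Relation.Nullary.Decidable using (⌊_⌋)
open import Relation.Binary.PropositionalEquality using (_≡_)

-- Formal power series in a variable t over ℚ (coefficient sequences).
-- We use t = z^{1/2}: the small roots u₁,u₂ are power series in z^{1/2}.

Series : Set
Series = ℕ → ℚ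

infix 4 _≈_
_≈_ : Series → Series → Set
f ≈ g = ∀ n → f n ≡ g n

0ₛ : Series
0ₛ _ = 0ℚ

1ₛ : Series
1ₛ zero = 1ℚ
1ₛ (suc _) = 0ℚ

tₛ : Series
tₛ (suc zero) = 1ℚ
tₛ _ = 0ℚ

infixl 6 _+ₛ_ _-ₛ_
infixl 7 _*ₛ_
infixr 8 _^ₛ_

_+ₛ_ : Series → Series → Series
(f +ₛ g) n = f n ℚ.+ g n

-ₛ_ : Series → Series
(-ₛ f) n = ℚ.- (f n)

_-ₛ_ : Series → Series → Series
f -ₛ g = f +ₛ (-ₛ g)

sumTo : (ℕ → ℚ) → ℕ → ℚ
sumTo a zero = a zero
sumTo a (suc n) = sumTo a n ℚ.+ a (suc n)

_*ₛ_ : Series → Series → Series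
(f *ₛ g) n = sumTo (λ i → f i ℚ.* g (n ℕ.∸ i)) n

_^ₛ_ : Series → ℕ → Series
f ^ₛ zero = 1ₛ
f ^ₛ suc n = f *ₛ (f ^ₛ n)

sumFrom1 : ℕ → (ℕ → Series) → Series
sumFrom1 zero f = 0ₛ
sumFrom1 (suc n) f = sumFrom1 n f +ₛ f (suc n)

-- a power series in z, seen as a series in t = z^{1/2}:  Σ a n z^n = Σ a n t^{2n}
inZ : (ℕ → ℚ) → Series
inZ a zero = a zero
inZ a (suc zero) = 0ℚ
inZ a (suc (suc m)) = inZ (λ n → a (suc n)) m

zₛ : Series
zₛ = tₛ ^ₛ 2

-- u is a root of 1 - z P(u) = 0 with P(u) = u^{-2}+u^{-1}+u+u^2,
-- written (after multiplying by u², legitimate as u ≠ 0) as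
-- u² = z (1 + u + u³ + u⁴).
IsRoot : Series → Set
IsRoot u = u ^ₛ 2 ≈ zₛ *ₛ (1ₛ +ₛ u +ₛ u ^ₛ 3 +ₛ u ^ₛ 4)

step : Fin 4 → ℤ
step Fin.zero = -[1+ 1 ]
step (Fin.suc Fin.zero) = -[1+ 0 ]
step (Fin.suc (Fin.suc Fin.zero)) = + 1
step (Fin.suc (Fin.suc (Fin.suc Fin.zero))) = + 2

allSteps : List (Fin 4)
allSteps = Fin.zero ∷ Fin.suc Fin.zero ∷ Fin.suc (Fin.suc Fin.zero)
         ∷ Fin.suc (Fin.suc (Fin.suc Fin.zero)) ∷ []

allWalks : (n : ℕ) → List (Vec (Fin 4) n)
allWalks zero = [] ∷ []
allWalks (suc n) = concatMap (λ s → map (s ∷_) (allWalks n)) allSteps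

ok : ℤ → ℕ → {n : ℕ} → Vec (Fin 4) n → Bool
ok a k [] = ⌊ a ℤ.≟ + k ⌋
ok a k (s ∷ []) = ⌊ a ℤ.+ step s ℤ.≟ + k ⌋
ok a k (s ∷ s' ∷ w) = ⌊ ℤ.0ℤ ℤP.<? a ℤ.+ step s ⌋ ∧ ok (a ℤ.+ step s) k (s' ∷ w)

countTrue : {A : Set} → (A → Bool) → List A → ℕ
countTrue p [] = 0
countTrue p (x ∷ xs) = if p x then suc (countTrue p xs) else countTrue p xs

walkCount : ℕ → ℕ → ℕ → ℕ
walkCount j k n = countTrue (ok (+ j) k) (allWalks n)

G : ℕ → ℕ → Series
G j k = inZ (λ n → + walkCount j k n ℚ./ 1)

module Submission where

-- Fix a target k > 0 and put F_b = z·G_{b,k} for b > 0, F_0 = 0.  Splitting a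
-- walk after its first step shows that (F_b) solves the linear system
--     F_a = z·(δ_{a,k} + Σ_{b ∈ N(a)} F_b)      (a ≥ 1),   N(a) = {a−2,a−1,a+1,a+2} ∩ ℕ,
-- and G_{0,k} = F_1 + F_2.  Since the right-hand side is divisible by z, this
-- system has at most one solution with F_0 = 0.  It therefore suffices to check
-- that C_b = −u₁u₂·Σ_{i=1}^{min(b,k)} h_{b−i}h_{k−i} solves it; this is algebra in
-- the power-series ring, using h_{m+2} = σh_{m+1} − πh_m (σ = u₁+u₂, π = u₁u₂),
-- h_a = z·Σ_{b∈N(a)} h_b (a ≥ 1), and σ + π + πσ = 0, all consequences of the
-- root equation u² = z(1 + u + u³ + u⁴) after cancelling the non-zero u₁ − u₂.

open import Defs
open import Data.Nat as ℕ using (ℕ; zero; suc; _∸_; _⊓_; _≤_; _<_; z≤n; s≤s)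
import Data.Nat.Properties as ℕP
open import Data.Nat.Coprimality using (1-coprimeTo) renaming (sym to coprime-sym)
open import Data.Nat.Induction using (<-rec)
open import Data.Nat.ListAction using (sum)
open import Data.Integer as ℤ using (ℤ; +_)
import Data.Integer.Properties as ℤP
open import Data.Rational as ℚ using (ℚ; 0ℚ; 1ℚ)
import Data.Rational.Properties as ℚP
open import Data.Rational.Solver using (module +-*-Solver)
open import Data.Fin using (Fin)
open import Data.Vec using (Vec; []; _∷_)
open import Data.List using (List; []; _∷_; _++_; map; concatMap)
open import Data.List.Properties using (map-cong)
open import Data.Bool using (Bool; true; false; _∧_; if_then_else_)
open import Data.Product using (Σ; _×_; _,_)
open import Data.Sum using (_⊎_; inj₁; inj₂)
open import Data.Maybe using (Maybe; just; nothing)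
open import Data.Empty using (⊥-elim)
open import Level using (0ℓ)
open import Algebra.Bundles using (CommutativeRing; CommutativeMonoid)
open import Algebra.Properties.CommutativeSemigroup (CommutativeMonoid.commutativeSemigroup ℚP.+-0-commutativeMonoid)
  using (interchange)
import Algebra.Solver.Ring
import Algebra.Solver.Ring.AlmostCommutativeRing as ACR
open import Relation.Nullary using (¬_; yes; no)
open import Relation.Nullary.Decidable using (⌊_⌋)
open import Relation.Binary.Definitions using (tri<; tri≈; tri>)
open import Relation.Binary.PropositionalEquality
import Relation.Binary.Reasoning.Setoid as SetoidReasoning

sumTo-cong : ∀ {a b : ℕ → ℚ} n → (∀ i → i ≤ n → a i ≡ b i) → sumTo a n ≡ sumTo b n
sumTo-cong zero e = e 0 z≤n
sumTo-cong (suc n) e =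
  cong₂ ℚ._+_ (sumTo-cong n (λ i i≤n → e i (ℕP.m≤n⇒m≤1+n i≤n))) (e (suc n) ℕP.≤-refl)

sumTo-peel : ∀ (a : ℕ → ℚ) n → sumTo a (suc n) ≡ a 0 ℚ.+ sumTo (λ i → a (suc i)) n
sumTo-peel a zero = refl
sumTo-peel a (suc n) =
  trans (cong (ℚ._+ a (suc (suc n))) (sumTo-peel a n)) (ℚP.+-assoc (a 0) _ _)

sumTo-+ : ∀ (a b : ℕ → ℚ) n → sumTo (λ i → a i ℚ.+ b i) n ≡ sumTo a n ℚ.+ sumTo b n
sumTo-+ a b zero = refl
sumTo-+ a b (suc n) =
  trans (cong (ℚ._+ (a (suc n) ℚ.+ b (suc n))) (sumTo-+ a b n))
        (interchange (sumTo a n) (sumTo b n) (a (suc n)) (b (suc n)))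

sumTo-*ˡ : ∀ c (a : ℕ → ℚ) n → sumTo (λ i → c ℚ.* a i) n ≡ c ℚ.* sumTo a n
sumTo-*ˡ c a zero = refl
sumTo-*ˡ c a (suc n) =
  trans (cong (ℚ._+ c ℚ.* a (suc n)) (sumTo-*ˡ c a n)) (sym (ℚP.*-distribˡ-+ c (sumTo a n) (a (suc n))))

sumTo-reverse : ∀ (a : ℕ → ℚ) n → sumTo (λ i → a (n ∸ i)) n ≡ sumTo a n
sumTo-reverse a zero = refl
sumTo-reverse a (suc n) = begin
    sumTo (λ i → a (suc n ∸ i)) (suc n)      ≡⟨ sumTo-peel (λ i → a (suc n ∸ i)) n ⟩
    a (suc n) ℚ.+ sumTo (λ i → a (n ∸ i)) n  ≡⟨ cong (a (suc n) ℚ.+_) (sumTo-reverse a n) ⟩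
    a (suc n) ℚ.+ sumTo a n                  ≡⟨ ℚP.+-comm (a (suc n)) (sumTo a n) ⟩
    sumTo a (suc n)                          ∎
  where open ≡-Reasoning

sumTo-zero : ∀ (a : ℕ → ℚ) n → (∀ i → i ≤ n → a i ≡ 0ℚ) → sumTo a n ≡ 0ℚ
sumTo-zero a n e = trans (sumTo-cong n e) (sumTo-const0 n)
  where
  sumTo-const0 : ∀ n → sumTo (λ _ → 0ℚ) n ≡ 0ℚ
  sumTo-const0 zero = refl
  sumTo-const0 (suc n) = cong (ℚ._+ 0ℚ) (sumTo-const0 n)

sumTo-single : ∀ (a : ℕ → ℚ) n p → p ≤ n → (∀ i → i ≤ n → i ≢ p → a i ≡ 0ℚ) → sumTo a n ≡ a p
sumTo-single a zero .zero z≤n e = refl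
sumTo-single a (suc n) p p≤1+n e with ℕP.m≤n⇒m<n∨m≡n p≤1+n
... | inj₁ p<1+n = begin
    sumTo a n ℚ.+ a (suc n)
      ≡⟨ cong₂ ℚ._+_ (sumTo-single a n p (ℕP.≤-pred p<1+n) (λ i i≤n → e i (ℕP.m≤n⇒m≤1+n i≤n)))
                     (e (suc n) ℕP.≤-refl (λ 1+n≡p → ℕP.<-irrefl (sym 1+n≡p) p<1+n)) ⟩
    a p ℚ.+ 0ℚ ≡⟨ ℚP.+-identityʳ (a p) ⟩
    a p        ∎
  where open ≡-Reasoning
... | inj₂ refl = begin
    sumTo a n ℚ.+ a (suc n)
      ≡⟨ cong (ℚ._+ a (suc n)) (sumTo-zero a n (λ i i≤n → e i (ℕP.m≤n⇒m≤1+n i≤n) (λ i≡1+n → ℕP.<-irrefl i≡1+n (s≤s i≤n)))) ⟩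
    0ℚ ℚ.+ a (suc n) ≡⟨ ℚP.+-identityˡ _ ⟩
    a (suc n)        ∎
  where open ≡-Reasoning

-- Commutativity comes from
-- reversing the Cauchy sum, associativity by induction on the index after
-- splitting off constant terms: (f g)ₙ₊₁ = f₀ gₙ₊₁ + (tail f · g)ₙ.

tail : Series → Series
tail f n = f (suc n)

*ₛ-suc : ∀ f g n → (f *ₛ g) (suc n) ≡ f 0 ℚ.* g (suc n) ℚ.+ (tail f *ₛ g) n
*ₛ-suc f g n = sumTo-peel (λ i → f i ℚ.* g (suc n ∸ i)) n

*ₛ-cong : ∀ {f f′ g g′} → f ≈ f′ → g ≈ g′ → f *ₛ g ≈ f′ *ₛ g′
*ₛ-cong f≈f′ g≈g′ n = sumTo-cong n λ i _ → cong₂ ℚ._*_ (f≈f′ i) (g≈g′ (n ∸ i))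

*ₛ-comm : ∀ f g → f *ₛ g ≈ g *ₛ f
*ₛ-comm f g n = trans (sym (sumTo-reverse _ n)) (sumTo-cong n λ i i≤n →
  trans (cong (λ j → f (n ∸ i) ℚ.* g j) (ℕP.m∸[m∸n]≡n i≤n)) (ℚP.*-comm (f (n ∸ i)) (g i)))

*ₛ-distribˡ : ∀ f g h → f *ₛ (g +ₛ h) ≈ f *ₛ g +ₛ f *ₛ h
*ₛ-distribˡ f g h n =
  trans (sumTo-cong n λ i _ → ℚP.*-distribˡ-+ (f i) (g (n ∸ i)) (h (n ∸ i))) (sumTo-+ _ _ n)

*ₛ-distribʳ : ∀ h f g → (f +ₛ g) *ₛ h ≈ f *ₛ h +ₛ g *ₛ h
*ₛ-distribʳ h f g n = trans (*ₛ-comm (f +ₛ g) h n)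
  (trans (*ₛ-distribˡ h f g n) (cong₂ ℚ._+_ (*ₛ-comm h f n) (*ₛ-comm h g n)))

*ₛ-identityˡ : ∀ f → 1ₛ *ₛ f ≈ f
*ₛ-identityˡ f zero = ℚP.*-identityˡ (f 0)
*ₛ-identityˡ f (suc n) = begin
    (1ₛ *ₛ f) (suc n)                              ≡⟨ *ₛ-suc 1ₛ f n ⟩
    1ℚ ℚ.* f (suc n) ℚ.+ (tail 1ₛ *ₛ f) n          ≡⟨ cong₂ ℚ._+_ (ℚP.*-identityˡ (f (suc n)))
                                                       (sumTo-zero _ n λ i _ → ℚP.*-zeroˡ (f (n ∸ i))) ⟩
    f (suc n) ℚ.+ 0ℚ                               ≡⟨ ℚP.+-identityʳ _ ⟩
    f (suc n)                                      ∎
  where open ≡-Reasoning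

scale : ℚ → Series → Series
scale c f n = c ℚ.* f n

scale-*ₛ : ∀ c f g → scale c f *ₛ g ≈ scale c (f *ₛ g)
scale-*ₛ c f g n = trans (sumTo-cong n λ i _ → ℚP.*-assoc c (f i) (g (n ∸ i))) (sumTo-*ˡ c _ n)

*ₛ-assoc : ∀ f g h → (f *ₛ g) *ₛ h ≈ f *ₛ (g *ₛ h)
*ₛ-assoc f g h zero = ℚP.*-assoc (f 0) (g 0) (h 0)
*ₛ-assoc f g h (suc n) = begin
    ((f *ₛ g) *ₛ h) (suc n)
      ≡⟨ *ₛ-suc (f *ₛ g) h n ⟩
    (f 0 ℚ.* g 0) ℚ.* h (suc n) ℚ.+ (tail (f *ₛ g) *ₛ h) n
      ≡⟨ cong ((f 0 ℚ.* g 0) ℚ.* h (suc n) ℚ.+_) tail-assoc ⟩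
    (f 0 ℚ.* g 0) ℚ.* h (suc n) ℚ.+ (f 0 ℚ.* (tail g *ₛ h) n ℚ.+ (tail f *ₛ (g *ₛ h)) n)
      ≡⟨ solve 5 (λ a b c d e → (a :* b) :* c :+ (a :* d :+ e) := a :* (b :* c :+ d) :+ e) refl
           (f 0) (g 0) (h (suc n)) ((tail g *ₛ h) n) ((tail f *ₛ (g *ₛ h)) n) ⟩
    f 0 ℚ.* (g 0 ℚ.* h (suc n) ℚ.+ (tail g *ₛ h) n) ℚ.+ (tail f *ₛ (g *ₛ h)) n
      ≡⟨ cong (λ x → f 0 ℚ.* x ℚ.+ (tail f *ₛ (g *ₛ h)) n) (sym (*ₛ-suc g h n)) ⟩
    f 0 ℚ.* (g *ₛ h) (suc n) ℚ.+ (tail f *ₛ (g *ₛ h)) n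
      ≡⟨ sym (*ₛ-suc f (g *ₛ h) n) ⟩
    (f *ₛ (g *ₛ h)) (suc n) ∎
  where
  open ≡-Reasoning
  open +-*-Solver
  -- tail (f g) = f₀ · tail g + tail f · g, then induction on the index.
  tail-assoc : (tail (f *ₛ g) *ₛ h) n ≡ f 0 ℚ.* (tail g *ₛ h) n ℚ.+ (tail f *ₛ (g *ₛ h)) n
  tail-assoc = trans (*ₛ-cong {tail (f *ₛ g)} {scale (f 0) (tail g) +ₛ tail f *ₛ g} {h} {h} (*ₛ-suc f g) (λ _ → refl) n)
               (trans (*ₛ-distribʳ h (scale (f 0) (tail g)) (tail f *ₛ g) n)
                      (cong₂ ℚ._+_ (scale-*ₛ (f 0) (tail g) h n) (*ₛ-assoc (tail f) g h n)))

seriesRing : CommutativeRing 0ℓ 0ℓ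
seriesRing = record
  { Carrier = Series ; _≈_ = _≈_ ; _+_ = _+ₛ_ ; _*_ = _*ₛ_ ; -_ = -ₛ_ ; 0# = 0ₛ ; 1# = 1ₛ
  ; isCommutativeRing = record
    { isRing = record
      { +-isAbelianGroup = record
        { isGroup = record
          { isMonoid = record
            { isSemigroup = record
              { isMagma = record
                { isEquivalence = record { refl = λ _ → refl ; sym = λ p n → sym (p n) ; trans = λ p q n → trans (p n) (q n) }
                ; ∙-cong = λ p q n → cong₂ ℚ._+_ (p n) (q n) }
              ; assoc = λ f g h n → ℚP.+-assoc (f n) (g n) (h n) }
            ; identity = (λ f n → ℚP.+-identityˡ (f n)) , (λ f n → ℚP.+-identityʳ (f n)) }
          ; inverse = (λ f n → ℚP.+-inverseˡ (f n)) , (λ f n → ℚP.+-inverseʳ (f n))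
          ; ⁻¹-cong = λ p n → cong ℚ.-_ (p n) }
        ; comm = λ f g n → ℚP.+-comm (f n) (g n) }
      ; *-cong = λ {f} {f′} {g} {g′} → *ₛ-cong {f} {f′} {g} {g′}
      ; *-assoc = *ₛ-assoc
      ; *-identity = *ₛ-identityˡ , (λ f n → trans (*ₛ-comm f 1ₛ n) (*ₛ-identityˡ f n))
      ; distrib = *ₛ-distribˡ , *ₛ-distribʳ }
    ; *-comm = *ₛ-comm } }

open CommutativeRing seriesRing
  using () renaming (setoid to seriesSetoid; refl to ≈-refl; sym to ≈-sym; trans to ≈-trans)

module ≈-Reasoning = SetoidReasoning seriesSetoid

-- Congruences with the fixed operand explicit (the equality on series is a
-- function type, so Agda cannot infer the operands from it).
*-congˡ : ∀ c {f g} → f ≈ g → c *ₛ f ≈ c *ₛ g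
*-congˡ c f≈g = *ₛ-cong {c} {c} (λ _ → refl) f≈g

*-congʳ : ∀ c {f g} → f ≈ g → f *ₛ c ≈ g *ₛ c
*-congʳ c {f} {g} f≈g = *ₛ-cong {f} {g} {c} {c} f≈g (λ _ → refl)

+-cong : ∀ {f f′ g g′} → f ≈ f′ → g ≈ g′ → f +ₛ g ≈ f′ +ₛ g′
+-cong p q n = cong₂ ℚ._+_ (p n) (q n)

+-congˡ : ∀ c {f g} → f ≈ g → c +ₛ f ≈ c +ₛ g
+-congˡ c = +-cong {c} {c} (λ _ → refl)

+-congʳ : ∀ c {f g} → f ≈ g → f +ₛ c ≈ g +ₛ c
+-congʳ c p = +-cong p (λ _ → refl)

-‿cong : ∀ {f g} → f ≈ g → -ₛ f ≈ -ₛ g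
-‿cong p n = cong ℚ.-_ (p n)

0ₛ-+ : ∀ X → 0ₛ +ₛ X ≈ X
0ₛ-+ X n = ℚP.+-identityˡ (X n)

constₛ : ℚ → Series
constₛ c zero = c
constₛ c (suc _) = 0ℚ

constₛ-0 : constₛ 0ℚ ≈ 0ₛ
constₛ-0 zero = refl
constₛ-0 (suc n) = refl

0ₛ≈const : 0ₛ ≈ constₛ 0ℚ
0ₛ≈const = ≈-sym constₛ-0

0ₛ-*ₛ : ∀ f → 0ₛ *ₛ f ≈ 0ₛ
0ₛ-*ₛ f n = sumTo-zero _ n (λ i _ → ℚP.*-zeroˡ (f (n ∸ i)))

constₛ-* : ∀ a b → constₛ (a ℚ.* b) ≈ constₛ a *ₛ constₛ b
constₛ-* a b zero = refl
constₛ-* a b (suc n) = sym (trans (*ₛ-suc (constₛ a) (constₛ b) n)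
  (trans (cong₂ ℚ._+_ (ℚP.*-zeroʳ a) (0ₛ-*ₛ (constₛ b) n)) (ℚP.+-identityˡ 0ℚ)))

constₛ-hom : ACR._-Raw-AlmostCommutative⟶_ ℚP.+-*-rawRing (ACR.fromCommutativeRing seriesRing)
constₛ-hom = record
  { ⟦_⟧ = constₛ
  ; +-homo = λ { a b zero → refl ; a b (suc n) → refl }
  ; *-homo = constₛ-*
  ; -‿homo = λ { a zero → refl ; a (suc n) → refl }
  ; 0-homo = constₛ-0
  ; 1-homo = λ { zero → refl ; (suc n) → refl } }

constₛ-≟ : ∀ (a b : ℚ) → Maybe (constₛ a ≈ constₛ b)
constₛ-≟ a b with a ℚP.≟ b
... | yes refl = just (λ _ → refl)
... | no _ = nothing

module SeriesSolver = Algebra.Solver.Ring ℚP.+-*-rawRing (ACR.fromCommutativeRing seriesRing) constₛ-hom constₛ-≟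
open SeriesSolver using (solve; _:=_; _:+_; _:*_; _:-_; :-_; _:^_; con)

-- Series over ℚ have no zero divisors: if E ≠ 0 has least non-zero
-- coefficient Eₚ, then (E D)ₚ₊ₘ = Eₚ Dₘ + (terms in D₀,…,Dₘ₋₁), so E D = 0
-- forces D = 0 by strong induction.

ℚ-*-cancel : ∀ x y → x ℚ.* y ≡ 0ℚ → x ≢ 0ℚ → y ≡ 0ℚ
ℚ-*-cancel x y xy≡0 x≢0 = begin
    y                      ≡⟨ sym (ℚP.*-identityˡ y) ⟩
    1ℚ ℚ.* y               ≡⟨ cong (ℚ._* y) (sym (ℚP.*-inverseˡ x)) ⟩
    (ℚ.1/ x) ℚ.* x ℚ.* y   ≡⟨ ℚP.*-assoc (ℚ.1/ x) x y ⟩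
    (ℚ.1/ x) ℚ.* (x ℚ.* y) ≡⟨ cong ((ℚ.1/ x) ℚ.*_) xy≡0 ⟩
    (ℚ.1/ x) ℚ.* 0ℚ        ≡⟨ ℚP.*-zeroʳ (ℚ.1/ x) ⟩
    0ℚ                     ∎
  where
  open ≡-Reasoning
  instance _ = ℚ.≢-nonZero x≢0

firstNonZero : (f : Series) (n : ℕ) → (∀ i → i ≤ n → f i ≡ 0ℚ)
             ⊎ Σ ℕ λ p → f p ≢ 0ℚ × (∀ i → i < p → f i ≡ 0ℚ)
firstNonZero f zero with f 0 ℚP.≟ 0ℚ
... | yes f₀≡0 = inj₁ λ { zero _ → f₀≡0 }
... | no f₀≢0 = inj₂ (0 , f₀≢0 , λ i ())
firstNonZero f (suc n) with firstNonZero f n | f (suc n) ℚP.≟ 0ℚ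
... | inj₂ least | _ = inj₂ least
... | inj₁ below | no fₙ₊₁≢0 = inj₂ (suc n , fₙ₊₁≢0 , λ i i<1+n → below i (ℕP.≤-pred i<1+n))
... | inj₁ below | yes fₙ₊₁≡0 = inj₁ λ i i≤1+n → case i i≤1+n
  where
  case : ∀ i → i ≤ suc n → f i ≡ 0ℚ
  case i i≤1+n with ℕP.m≤n⇒m<n∨m≡n i≤1+n
  ... | inj₁ i<1+n = below i (ℕP.≤-pred i<1+n)
  ... | inj₂ refl = fₙ₊₁≡0

noZeroDivisors : ∀ E D → E *ₛ D ≈ 0ₛ → ¬ (D ≈ 0ₛ) → E ≈ 0ₛ
noZeroDivisors E D ED≡0 D≢0 n with firstNonZero E n
... | inj₁ below = below n ℕP.≤-refl
... | inj₂ (p , Eₚ≢0 , below) = ⊥-elim (D≢0 (<-rec (λ m → D m ≡ 0ℚ) D-vanishes))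
  where
  D-vanishes : ∀ m → (∀ {j} → j < m → D j ≡ 0ℚ) → D m ≡ 0ℚ
  D-vanishes m ih = ℚ-*-cancel (E p) (D m) EₚDₘ≡0 Eₚ≢0
    where
    open ≡-Reasoning
    others : ∀ i → i ≤ p ℕ.+ m → i ≢ p → E i ℚ.* D (p ℕ.+ m ∸ i) ≡ 0ℚ
    others i i≤p+m i≢p with ℕP.<-cmp i p
    ... | tri< i<p _ _ = trans (cong (ℚ._* D (p ℕ.+ m ∸ i)) (below i i<p)) (ℚP.*-zeroˡ (D (p ℕ.+ m ∸ i)))
    ... | tri≈ _ i≡p _ = ⊥-elim (i≢p i≡p)
    ... | tri> _ _ p<i = trans (cong (E i ℚ.*_) (ih p+m∸i<m)) (ℚP.*-zeroʳ (E i))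
      where
      p+m∸i<m : p ℕ.+ m ∸ i < m
      p+m∸i<m = subst (p ℕ.+ m ∸ i <_) (ℕP.m+n∸m≡n p m) (ℕP.∸-monoʳ-< p<i i≤p+m)
    EₚDₘ≡0 : E p ℚ.* D m ≡ 0ℚ
    EₚDₘ≡0 = begin
      E p ℚ.* D m              ≡⟨ cong (λ k → E p ℚ.* D k) (sym (ℕP.m+n∸m≡n p m)) ⟩
      E p ℚ.* D (p ℕ.+ m ∸ p)  ≡⟨ sym (sumTo-single _ (p ℕ.+ m) p (ℕP.m≤m+n p m) others) ⟩
      (E *ₛ D) (p ℕ.+ m)       ≡⟨ ED≡0 (p ℕ.+ m) ⟩
      0ℚ                       ∎

difference-zero : ∀ {X Y} → X ≈ Y → X -ₛ Y ≈ 0ₛ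
difference-zero {X} {Y} X≈Y = begin
  X -ₛ Y     ≈⟨ +-congʳ (-ₛ Y) X≈Y ⟩
  Y -ₛ Y     ≈⟨ solve 1 (λ y → y :- y := con 0ℚ) (λ _ → refl) Y ⟩
  constₛ 0ℚ  ≈⟨ constₛ-0 ⟩
  0ₛ         ∎
  where open ≈-Reasoning

difference-zero⁻¹ : ∀ {X Y} → X -ₛ Y ≈ 0ₛ → X ≈ Y
difference-zero⁻¹ {X} {Y} X-Y≈0 = begin
  X               ≈⟨ solve 2 (λ x y → x := (x :- y) :+ y) (λ _ → refl) X Y ⟩
  (X -ₛ Y) +ₛ Y   ≈⟨ +-congʳ Y (≈-trans X-Y≈0 (≈-sym constₛ-0)) ⟩
  constₛ 0ℚ +ₛ Y  ≈⟨ solve 1 (λ y → con 0ℚ :+ y := y) (λ _ → refl) Y ⟩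
  Y               ∎
  where open ≈-Reasoning

*-cancelʳ : ∀ {X Y} C → ¬ (C ≈ 0ₛ) → X *ₛ C ≈ Y *ₛ C → X ≈ Y
*-cancelʳ {X} {Y} C C≢0 XC≈YC = difference-zero⁻¹ (noZeroDivisors (X -ₛ Y) C [X-Y]C≈0 C≢0)
  where
  [X-Y]C≈0 : (X -ₛ Y) *ₛ C ≈ 0ₛ
  [X-Y]C≈0 = begin
    (X -ₛ Y) *ₛ C     ≈⟨ solve 3 (λ x y c → (x :- y) :* c := x :* c :- y :* c) (λ _ → refl) X Y C ⟩
    X *ₛ C -ₛ Y *ₛ C  ≈⟨ difference-zero XC≈YC ⟩
    0ₛ                ∎
    where open ≈-Reasoning

-- Multiplication by t and by z = t² shifts coefficients up by one and two;
-- this is what makes the first-passage system below uniquely solvable.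

t-*-coeff₀ : ∀ X → (tₛ *ₛ X) 0 ≡ 0ℚ
t-*-coeff₀ X = ℚP.*-zeroˡ (X 0)

t-*-coeff : ∀ X m → (tₛ *ₛ X) (suc m) ≡ X m
t-*-coeff X m = begin
    (tₛ *ₛ X) (suc m)                      ≡⟨ *ₛ-suc tₛ X m ⟩
    0ℚ ℚ.* X (suc m) ℚ.+ (tail tₛ *ₛ X) m  ≡⟨ cong₂ ℚ._+_ (ℚP.*-zeroˡ (X (suc m))) tail-t ⟩
    0ℚ ℚ.+ X m                             ≡⟨ ℚP.+-identityˡ (X m) ⟩
    X m                                    ∎
  where
  open ≡-Reasoning
  tail-t : (tail tₛ *ₛ X) m ≡ X m
  tail-t = trans (*ₛ-cong {tail tₛ} {1ₛ} {X} {X} (λ { zero → refl ; (suc n) → refl }) (λ _ → refl) m)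
                 (*ₛ-identityˡ X m)

z-*ₛ : ∀ X → zₛ *ₛ X ≈ tₛ *ₛ (tₛ *ₛ X)
z-*ₛ X = solve 2 (λ t x → t :^ 2 :* x := t :* (t :* x)) (λ _ → refl) tₛ X

z-*-coeff₀ : ∀ X → (zₛ *ₛ X) 0 ≡ 0ℚ
z-*-coeff₀ X = trans (z-*ₛ X 0) (t-*-coeff₀ (tₛ *ₛ X))

z-*-coeff₁ : ∀ X → (zₛ *ₛ X) 1 ≡ 0ℚ
z-*-coeff₁ X = trans (z-*ₛ X 1) (trans (t-*-coeff (tₛ *ₛ X) 0) (t-*-coeff₀ X))

z-*-coeff : ∀ X m → (zₛ *ₛ X) (suc (suc m)) ≡ X m
z-*-coeff X m = trans (z-*ₛ X (suc (suc m))) (trans (t-*-coeff (tₛ *ₛ X) (suc m)) (t-*-coeff X m))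

neighbourSum : {A : Set} → (A → A → A) → (ℕ → A) → ℕ → A
neighbourSum _⊕_ f zero = f 1 ⊕ f 2
neighbourSum _⊕_ f (suc zero) = (f 0 ⊕ f 2) ⊕ f 3
neighbourSum _⊕_ f (suc (suc a)) = ((f a ⊕ f (suc a)) ⊕ f (3 ℕ.+ a)) ⊕ f (4 ℕ.+ a)

neighbourSum-hom : ∀ {A B : Set} (_⊕_ : A → A → A) (_⊞_ : B → B → B) (φ : A → B) →
                   (∀ x y → φ (x ⊕ y) ≡ φ x ⊞ φ y) →
                   ∀ f a → φ (neighbourSum _⊕_ f a) ≡ neighbourSum _⊞_ (λ b → φ (f b)) a
neighbourSum-hom _⊕_ _⊞_ φ φ-+ f zero = φ-+ (f 1) (f 2)
neighbourSum-hom _⊕_ _⊞_ φ φ-+ f (suc zero) =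
  trans (φ-+ (f 0 ⊕ f 2) (f 3)) (cong (_⊞ φ (f 3)) (φ-+ (f 0) (f 2)))
neighbourSum-hom _⊕_ _⊞_ φ φ-+ f (suc (suc a)) =
  trans (φ-+ _ (f (4 ℕ.+ a))) (cong (_⊞ φ (f (4 ℕ.+ a)))
    (trans (φ-+ _ (f (3 ℕ.+ a))) (cong (_⊞ φ (f (3 ℕ.+ a))) (φ-+ (f a) (f (suc a))))))

neighbourSum-cong : ∀ {A : Set} (_⊕_ : A → A → A) {f g : ℕ → A} → (∀ b → f b ≡ g b) →
                    ∀ a → neighbourSum _⊕_ f a ≡ neighbourSum _⊕_ g a
neighbourSum-cong _⊕_ e zero = cong₂ _⊕_ (e 1) (e 2)
neighbourSum-cong _⊕_ e (suc zero) = cong₂ _⊕_ (cong₂ _⊕_ (e 0) (e 2)) (e 3)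
neighbourSum-cong _⊕_ e (suc (suc a)) =
  cong₂ _⊕_ (cong₂ _⊕_ (cong₂ _⊕_ (e a) (e (suc a))) (e (3 ℕ.+ a))) (e (4 ℕ.+ a))

nbr : (ℕ → Series) → ℕ → Series
nbr = neighbourSum _+ₛ_

nbr-coeff : ∀ F a n → nbr F a n ≡ neighbourSum ℚ._+_ (λ b → F b n) a
nbr-coeff F a n = neighbourSum-hom _+ₛ_ ℚ._+_ (λ X → X n) (λ _ _ → refl) F a

nbr-coeff-zero : ∀ F a n → (∀ b → F b n ≡ 0ℚ) → nbr F a n ≡ 0ℚ
nbr-coeff-zero F a n F·ₙ≡0 =
  trans (nbr-coeff F a n) (trans (neighbourSum-cong ℚ._+_ F·ₙ≡0 a) (zeros a))
  where
  zeros : ∀ a → neighbourSum ℚ._+_ (λ _ → 0ℚ) a ≡ 0ℚ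
  zeros zero = refl
  zeros (suc zero) = refl
  zeros (suc (suc a)) = refl

δₛ : ℕ → ℕ → Series
δₛ zero zero = 1ₛ
δₛ zero (suc k) = 0ₛ
δₛ (suc a) zero = 0ₛ
δₛ (suc a) (suc k) = δₛ a k

δₛ-coeff : ∀ a k n → δₛ a k (suc n) ≡ 0ℚ
δₛ-coeff zero zero n = refl
δₛ-coeff zero (suc k) n = refl
δₛ-coeff (suc a) zero n = refl
δₛ-coeff (suc a) (suc k) n = δₛ-coeff a k n

ℕ→ℚ : ℕ → ℚ
ℕ→ℚ n = + n ℚ./ 1

ℕ→ℚ-+ : ∀ a b → ℕ→ℚ (a ℕ.+ b) ≡ ℕ→ℚ a ℚ.+ ℕ→ℚ b
ℕ→ℚ-+ a b = trans (cong ℕ→ℚ (sym (cong₂ ℕ._+_ (ℕP.*-identityʳ a) (ℕP.*-identityʳ b)))) (sym (by-cases a b))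
  where
  -- on canonical forms n/1 the rational sum computes
  canonical : ∀ n → ℕ→ℚ n ≡ ℚ.mkℚ (+ n) 0 (coprime-sym (1-coprimeTo n))
  canonical n = ℚP.normalize-coprime (coprime-sym (1-coprimeTo n))
  by-cases : ∀ a b → ℕ→ℚ a ℚ.+ ℕ→ℚ b ≡ ℕ→ℚ (a ℕ.* 1 ℕ.+ b ℕ.* 1)
  by-cases zero zero = refl
  by-cases zero (suc b) rewrite canonical (suc b) = refl
  by-cases (suc a) zero rewrite canonical (suc a) = refl
  by-cases (suc a) (suc b) rewrite canonical (suc a) | canonical (suc b) = refl

walkCount-zero : ∀ a k → ℕ→ℚ (walkCount a k 0) ≡ δₛ a k 0
walkCount-zero a k with + a ℤ.≟ + k
... | yes a≡k rewrite ℤP.+-injective a≡k = sym (diagonal k)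
  where
  diagonal : ∀ a → δₛ a a 0 ≡ 1ℚ
  diagonal zero = refl
  diagonal (suc a) = diagonal a
... | no a≢k = sym (off-diagonal a k (λ a≡k → a≢k (cong +_ a≡k)))
  where
  off-diagonal : ∀ a k → a ≢ k → δₛ a k 0 ≡ 0ℚ
  off-diagonal zero zero a≢k = ⊥-elim (a≢k refl)
  off-diagonal zero (suc k) _ = refl
  off-diagonal (suc a) zero _ = refl
  off-diagonal (suc a) (suc k) a≢k = off-diagonal a k (λ a≡k → a≢k (cong suc a≡k))

inZ-cong : ∀ {f g : ℕ → ℚ} → (∀ n → f n ≡ g n) → ∀ m → inZ f m ≡ inZ g m
inZ-cong e zero = e 0
inZ-cong e (suc zero) = refl
inZ-cong e (suc (suc m)) = inZ-cong (λ n → e (suc n)) m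

inZ-+ : ∀ (f g : ℕ → ℚ) m → inZ (λ n → f n ℚ.+ g n) m ≡ inZ f m ℚ.+ inZ g m
inZ-+ f g zero = refl
inZ-+ f g (suc zero) = refl
inZ-+ f g (suc (suc m)) = inZ-+ (λ n → f (suc n)) (λ n → g (suc n)) m

inZ-0 : ∀ m → inZ (λ _ → 0ℚ) m ≡ 0ℚ
inZ-0 zero = refl
inZ-0 (suc zero) = refl
inZ-0 (suc (suc m)) = inZ-0 m

countTrue-++ : ∀ {A : Set} (p : A → Bool) xs ys → countTrue p (xs ++ ys) ≡ countTrue p xs ℕ.+ countTrue p ys
countTrue-++ p [] ys = refl
countTrue-++ p (x ∷ xs) ys with p x
... | true = cong suc (countTrue-++ p xs ys)
... | false = countTrue-++ p xs ys

countTrue-concatMap : ∀ {A B : Set} (p : B → Bool) (f : A → List B) xs →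
                      countTrue p (concatMap f xs) ≡ sum (map (λ x → countTrue p (f x)) xs)
countTrue-concatMap p f [] = refl
countTrue-concatMap p f (x ∷ xs) =
  trans (countTrue-++ p (f x) (concatMap f xs)) (cong (countTrue p (f x) ℕ.+_) (countTrue-concatMap p f xs))

countTrue-map : ∀ {A B : Set} (p : B → Bool) (f : A → B) xs → countTrue p (map f xs) ≡ countTrue (λ x → p (f x)) xs
countTrue-map p f [] = refl
countTrue-map p f (x ∷ xs) with p (f x)
... | true = cong suc (countTrue-map p f xs)
... | false = countTrue-map p f xs

countTrue-cong : ∀ {A : Set} {p q : A → Bool} → (∀ x → p x ≡ q x) → ∀ xs → countTrue p xs ≡ countTrue q xs
countTrue-cong e [] = refl
countTrue-cong {q = q} e (x ∷ xs) rewrite e x with q x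
... | true = cong suc (countTrue-cong e xs)
... | false = countTrue-cong e xs

countTrue-guard : ∀ {A : Set} (b : Bool) (q : A → Bool) xs →
                  countTrue (λ x → b ∧ q x) xs ≡ (if b then countTrue q xs else 0)
countTrue-guard true q xs = refl
countTrue-guard false q [] = refl
countTrue-guard false q (x ∷ xs) = countTrue-guard false q xs

continuations : ℤ → ℕ → ℕ → ℕ
continuations x k n = if ⌊ ℤ.0ℤ ℤP.<? x ⌋ then countTrue (ok x k) (allWalks n) else 0

-- For a positive target altitude the endpoint is automatically positive,
-- so "every point after the start is positive" is checked step by step.
ok-cons : ∀ (a : ℤ) k s {n} (w : Vec (Fin 4) n) →
          ok a (suc k) (s ∷ w) ≡ ⌊ ℤ.0ℤ ℤP.<? a ℤ.+ step s ⌋ ∧ ok (a ℤ.+ step s) (suc k) w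
ok-cons a k s [] = endpoint-positive (a ℤ.+ step s)
  where
  endpoint-positive : ∀ x → ⌊ x ℤ.≟ + suc k ⌋ ≡ ⌊ ℤ.0ℤ ℤP.<? x ⌋ ∧ ⌊ x ℤ.≟ + suc k ⌋
  endpoint-positive x with x ℤ.≟ + suc k
  ... | yes refl = refl
  ... | no _ with ⌊ ℤ.0ℤ ℤP.<? x ⌋
  ...   | true = refl
  ...   | false = refl
ok-cons a k s (_ ∷ _) = refl

walks-by-first-step : ∀ (a : ℤ) k s n →
  countTrue (ok a (suc k)) (map (s ∷_) (allWalks n)) ≡ continuations (a ℤ.+ step s) (suc k) n
walks-by-first-step a k s n =
  trans (countTrue-map (ok a (suc k)) (s ∷_) (allWalks n))
        (trans (countTrue-cong (ok-cons a k s) (allWalks n)) (countTrue-guard _ _ (allWalks n)))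

positiveCount : ℕ → ℕ → ℕ → ℕ
positiveCount zero k n = 0
positiveCount (suc b) k n = walkCount (suc b) k n

continuations-as-neighbours : ∀ a K n →
  sum (map (λ s → continuations (+ a ℤ.+ step s) K n) allSteps) ≡ neighbourSum ℕ._+_ (λ b → positiveCount b K n) a
continuations-as-neighbours a K n = by-altitude a
  where
  c : ℕ → ℕ
  c b = positiveCount b K n
  reassociate : ∀ p q r s → p ℕ.+ (q ℕ.+ (r ℕ.+ (s ℕ.+ 0))) ≡ ((p ℕ.+ q) ℕ.+ r) ℕ.+ s
  reassociate p q r s rewrite ℕP.+-identityʳ s | ℕP.+-assoc (p ℕ.+ q) r s = sym (ℕP.+-assoc p q (r ℕ.+ s))
  by-altitude : ∀ a → sum (map (λ s → continuations (+ a ℤ.+ step s) K n) allSteps)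
                      ≡ neighbourSum ℕ._+_ c a
  by-altitude zero = reassociate 0 0 (c 1) (c 2)
  by-altitude (suc zero) = reassociate 0 0 (c 2) (c 3)
  by-altitude (suc (suc zero)) = reassociate 0 (c 1) (c 3) (c 4)
  by-altitude (suc (suc (suc a))) =
    trans (cong₂ (λ x y → c (suc a) ℕ.+ (c (2 ℕ.+ a) ℕ.+ (c x ℕ.+ (c y ℕ.+ 0))))
                 (ℕP.+-comm (3 ℕ.+ a) 1) (ℕP.+-comm (3 ℕ.+ a) 2))
          (reassociate (c (suc a)) (c (2 ℕ.+ a)) (c (4 ℕ.+ a)) (c (5 ℕ.+ a)))

walkCount-firstStep : ∀ a k n →
  walkCount a (suc k) (suc n) ≡ neighbourSum ℕ._+_ (λ b → positiveCount b (suc k) n) a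
walkCount-firstStep a k n = begin
    walkCount a (suc k) (suc n)
      ≡⟨ countTrue-concatMap (ok (+ a) (suc k)) (λ s → map (s ∷_) (allWalks n)) allSteps ⟩
    sum (map (λ s → countTrue (ok (+ a) (suc k)) (map (s ∷_) (allWalks n))) allSteps)
      ≡⟨ cong sum (map-cong (λ s → walks-by-first-step (+ a) k s n) allSteps) ⟩
    sum (map (λ s → continuations (+ a ℤ.+ step s) (suc k) n) allSteps)
      ≡⟨ continuations-as-neighbours a (suc k) n ⟩
    neighbourSum ℕ._+_ (λ b → positiveCount b (suc k) n) a ∎
  where open ≡-Reasoning

inZ-neighbourSum : ∀ (c : ℕ → ℕ → ℕ) a m →
  inZ (λ n → ℕ→ℚ (neighbourSum ℕ._+_ (λ b → c b n) a)) m
    ≡ neighbourSum ℚ._+_ (λ b → inZ (λ n → ℕ→ℚ (c b n)) m) a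
inZ-neighbourSum c a m =
  trans (inZ-cong (λ n → cong ℕ→ℚ (sym (pointwise n))) m) (neighbourSum-hom _+ᵖ_ ℚ._+_ φ φ-+ c a)
  where
  _+ᵖ_ : (ℕ → ℕ) → (ℕ → ℕ) → ℕ → ℕ
  (x +ᵖ y) n = x n ℕ.+ y n
  pointwise : ∀ n → neighbourSum _+ᵖ_ c a n ≡ neighbourSum ℕ._+_ (λ b → c b n) a
  pointwise n = neighbourSum-hom _+ᵖ_ ℕ._+_ (λ x → x n) (λ _ _ → refl) c a
  φ : (ℕ → ℕ) → ℚ
  φ x = inZ (λ n → ℕ→ℚ (x n)) m
  φ-+ : ∀ x y → φ (x +ᵖ y) ≡ φ x ℚ.+ φ y
  φ-+ x y = trans (inZ-cong (λ n → ℕ→ℚ-+ (x n) (y n)) m) (inZ-+ _ _ m)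

-- F_b = z G_{b,K} for b > 0 and F_0 = 0: first-passage walks to K,
-- with one extra factor z for the first step.
firstPassage : ℕ → ℕ → Series
firstPassage K zero = 0ₛ
firstPassage K (suc b) = zₛ *ₛ G (suc b) K

firstPassage-coeff₀ : ∀ K b → firstPassage K b 0 ≡ 0ℚ
firstPassage-coeff₀ K zero = refl
firstPassage-coeff₀ K (suc b) = z-*-coeff₀ (G (suc b) K)

firstPassage-coeff₁ : ∀ K b → firstPassage K b 1 ≡ 0ℚ
firstPassage-coeff₁ K zero = refl
firstPassage-coeff₁ K (suc b) = z-*-coeff₁ (G (suc b) K)

firstPassage-coeff : ∀ K b m → firstPassage K b (suc (suc m)) ≡ inZ (λ n → ℕ→ℚ (positiveCount b K n)) m
firstPassage-coeff K zero m = sym (inZ-0 m)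
firstPassage-coeff K (suc b) m = z-*-coeff (G (suc b) K) m

G-firstStep : ∀ k a → G a (suc k) ≈ δₛ a (suc k) +ₛ nbr (firstPassage (suc k)) a
G-firstStep k a zero = begin
    ℕ→ℚ (walkCount a (suc k) 0)        ≡⟨ walkCount-zero a (suc k) ⟩
    δₛ a (suc k) 0                      ≡⟨ sym (ℚP.+-identityʳ _) ⟩
    δₛ a (suc k) 0 ℚ.+ 0ℚ               ≡⟨ cong (δₛ a (suc k) 0 ℚ.+_)
                                            (sym (nbr-coeff-zero _ a 0 (firstPassage-coeff₀ (suc k)))) ⟩
    (δₛ a (suc k) +ₛ nbr (firstPassage (suc k)) a) 0 ∎
  where open ≡-Reasoning
G-firstStep k a (suc zero) =
  sym (cong₂ ℚ._+_ (δₛ-coeff a (suc k) 0) (nbr-coeff-zero _ a 1 (firstPassage-coeff₁ (suc k))))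
G-firstStep k a (suc (suc m)) = begin
    inZ (λ n → ℕ→ℚ (walkCount a (suc k) (suc n))) m
      ≡⟨ inZ-cong (λ n → cong ℕ→ℚ (walkCount-firstStep a k n)) m ⟩
    inZ (λ n → ℕ→ℚ (neighbourSum ℕ._+_ (λ b → positiveCount b (suc k) n) a)) m
      ≡⟨ inZ-neighbourSum (λ b n → positiveCount b (suc k) n) a m ⟩
    neighbourSum ℚ._+_ (λ b → inZ (λ n → ℕ→ℚ (positiveCount b (suc k) n)) m) a
      ≡⟨ neighbourSum-cong ℚ._+_ (λ b → sym (firstPassage-coeff (suc k) b m)) a ⟩
    neighbourSum ℚ._+_ (λ b → firstPassage (suc k) b (suc (suc m))) a
      ≡⟨ sym (nbr-coeff (firstPassage (suc k)) a (suc (suc m))) ⟩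
    nbr (firstPassage (suc k)) a (suc (suc m))
      ≡⟨ sym (ℚP.+-identityˡ _) ⟩
    0ℚ ℚ.+ nbr (firstPassage (suc k)) a (suc (suc m))
      ≡⟨ cong (ℚ._+ nbr (firstPassage (suc k)) a (suc (suc m))) (sym (δₛ-coeff a (suc k) (suc m))) ⟩
    (δₛ a (suc k) +ₛ nbr (firstPassage (suc k)) a) (suc (suc m)) ∎
  where open ≡-Reasoning

SolvesSystem : ℕ → (ℕ → Series) → Set
SolvesSystem K F = ∀ a → F (suc a) ≈ zₛ *ₛ (δₛ (suc a) K +ₛ nbr F (suc a))

firstPassage-solves : ∀ k → SolvesSystem (suc k) (firstPassage (suc k))
firstPassage-solves k a = *-congˡ zₛ (G-firstStep k (suc a))

-- The system determines F from F_0: the coefficient of t^{n+2} in F_a only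
-- involves the coefficients of t^n in the F_b, so strong induction on n.
system-unique : ∀ K (F F′ : ℕ → Series) → F 0 ≈ F′ 0 → SolvesSystem K F → SolvesSystem K F′ →
                ∀ a → F a ≈ F′ a
system-unique K F F′ F₀≈F′₀ F-solves F′-solves a n = <-rec (λ n → ∀ a → F a n ≡ F′ a n) by-index n a
  where
  rhs : (ℕ → Series) → ℕ → Series
  rhs H a = δₛ (suc a) K +ₛ nbr H (suc a)
  by-index : ∀ n → (∀ {j} → j < n → ∀ a → F a j ≡ F′ a j) → ∀ a → F a n ≡ F′ a n
  by-index n ih zero = F₀≈F′₀ n
  by-index zero ih (suc a) =
    trans (F-solves a 0) (trans (z-*-coeff₀ (rhs F a)) (sym (trans (F′-solves a 0) (z-*-coeff₀ (rhs F′ a)))))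
  by-index (suc zero) ih (suc a) =
    trans (F-solves a 1) (trans (z-*-coeff₁ (rhs F a)) (sym (trans (F′-solves a 1) (z-*-coeff₁ (rhs F′ a)))))
  by-index (suc (suc m)) ih (suc a) = begin
      F (suc a) (suc (suc m))                   ≡⟨ F-solves a (suc (suc m)) ⟩
      (zₛ *ₛ rhs F a) (suc (suc m))             ≡⟨ z-*-coeff (rhs F a) m ⟩
      δₛ (suc a) K m ℚ.+ nbr F (suc a) m        ≡⟨ cong (δₛ (suc a) K m ℚ.+_) nbr-agrees ⟩
      δₛ (suc a) K m ℚ.+ nbr F′ (suc a) m       ≡⟨ sym (z-*-coeff (rhs F′ a) m) ⟩
      (zₛ *ₛ rhs F′ a) (suc (suc m))            ≡⟨ sym (F′-solves a (suc (suc m))) ⟩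
      F′ (suc a) (suc (suc m))                  ∎
    where
    open ≡-Reasoning
    nbr-agrees : nbr F (suc a) m ≡ nbr F′ (suc a) m
    nbr-agrees = trans (nbr-coeff F (suc a) m)
      (trans (neighbourSum-cong ℚ._+_ (λ b → ih (ℕP.m≤n⇒m≤1+n (ℕP.n<1+n m)) b) (suc a))
             (sym (nbr-coeff F′ (suc a) m)))

sumFrom1-peel : ∀ n f → sumFrom1 (suc n) f ≈ f 1 +ₛ sumFrom1 n (λ i → f (suc i))
sumFrom1-peel zero f m = ℚP.+-comm 0ℚ (f 1 m)
sumFrom1-peel (suc n) f m = trans (cong (ℚ._+ f (suc (suc n)) m) (sumFrom1-peel n f m))
  (ℚP.+-assoc (f 1 m) (sumFrom1 n (λ i → f (suc i)) m) (f (suc (suc n)) m))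

module Roots (u₁ u₂ : Series) (u₁₀ : u₁ 0 ≡ 0ℚ) (u₂₀ : u₂ 0 ≡ 0ℚ)
             (root₁ : IsRoot u₁) (root₂ : IsRoot u₂) (u₁≢u₂ : ¬ (u₁ ≈ u₂))
             (h : ℕ → Series) (h-def : ∀ m → h m *ₛ (u₁ -ₛ u₂) ≈ u₁ ^ₛ suc m -ₛ u₂ ^ₛ suc m) where

  open ≈-Reasoning

  Δ σ π : Series
  Δ = u₁ -ₛ u₂
  σ = u₁ +ₛ u₂
  π = u₁ *ₛ u₂

  Q : Series → Series
  Q u = 1ₛ +ₛ u +ₛ u ^ₛ 3 +ₛ u ^ₛ 4

  Δ≢0 : ¬ (Δ ≈ 0ₛ)
  Δ≢0 Δ≈0 = u₁≢u₂ (difference-zero⁻¹ Δ≈0)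

  -- Identities for h are proved after multiplying by Δ ≠ 0.
  h₀ : h 0 ≈ 1ₛ
  h₀ = *-cancelʳ Δ Δ≢0 (begin
    h 0 *ₛ Δ             ≈⟨ h-def 0 ⟩
    u₁ ^ₛ 1 -ₛ u₂ ^ₛ 1   ≈⟨ solve 2 (λ a b → a :^ 1 :- b :^ 1 := a :^ 0 :* (a :- b)) (λ _ → refl) u₁ u₂ ⟩
    1ₛ *ₛ Δ              ∎)

  h₁ : h 1 ≈ σ
  h₁ = *-cancelʳ Δ Δ≢0 (begin
    h 1 *ₛ Δ             ≈⟨ h-def 1 ⟩
    u₁ ^ₛ 2 -ₛ u₂ ^ₛ 2   ≈⟨ solve 2 (λ a b → a :^ 2 :- b :^ 2 := (a :+ b) :* (a :- b)) (λ _ → refl) u₁ u₂ ⟩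
    σ *ₛ Δ               ∎)

  h-rec : ∀ m → h (suc (suc m)) ≈ σ *ₛ h (suc m) -ₛ π *ₛ h m
  h-rec m = *-cancelʳ Δ Δ≢0 (begin
    h (suc (suc m)) *ₛ Δ                           ≈⟨ h-def (suc (suc m)) ⟩
    u₁ *ₛ (u₁ *ₛ x₁) -ₛ u₂ *ₛ (u₂ *ₛ x₂)
      ≈⟨ solve 4 (λ a b x y → a :* (a :* x) :- b :* (b :* y)
                              := (a :+ b) :* (a :* x :- b :* y) :- (a :* b) :* (x :- y)) (λ _ → refl) u₁ u₂ x₁ x₂ ⟩
    σ *ₛ (u₁ *ₛ x₁ -ₛ u₂ *ₛ x₂) -ₛ π *ₛ (x₁ -ₛ x₂)
      ≈⟨ +-cong (*-congˡ σ (≈-sym (h-def (suc m)))) (-‿cong (*-congˡ π (≈-sym (h-def m)))) ⟩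
    σ *ₛ (h (suc m) *ₛ Δ) -ₛ π *ₛ (h m *ₛ Δ)
      ≈⟨ solve 5 (λ s p a b d → s :* (a :* d) :- p :* (b :* d) := (s :* a :- p :* b) :* d) (λ _ → refl)
           σ π (h (suc m)) (h m) Δ ⟩
    (σ *ₛ h (suc m) -ₛ π *ₛ h m) *ₛ Δ              ∎)
    where
    x₁ = u₁ ^ₛ suc m
    x₂ = u₂ ^ₛ suc m

  -- The root equation, multiplied by u^{m+1}, makes h satisfy the walk
  -- recursion: h_a = z Σ_{b ∈ N(a)} h_b for a ≥ 1.
  h-neighbours : ∀ a → h (suc a) ≈ zₛ *ₛ nbr h (suc a)
  h-neighbours zero = *-cancelʳ Δ Δ≢0 (begin
    h 1 *ₛ Δ                   ≈⟨ h-def 1 ⟩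
    u₁ ^ₛ 2 -ₛ u₂ ^ₛ 2         ≈⟨ +-cong root₁ (-‿cong root₂) ⟩
    zₛ *ₛ Q u₁ -ₛ zₛ *ₛ Q u₂
      ≈⟨ solve 3 (λ z a b → z :* (a :^ 0 :+ a :+ a :^ 3 :+ a :^ 4) :- z :* (b :^ 0 :+ b :+ b :^ 3 :+ b :^ 4)
                            := z :* ((a :^ 1 :- b :^ 1) :+ (a :^ 3 :- b :^ 3) :+ (a :^ 4 :- b :^ 4))) (λ _ → refl) zₛ u₁ u₂ ⟩
    zₛ *ₛ ((u₁ ^ₛ 1 -ₛ u₂ ^ₛ 1) +ₛ (u₁ ^ₛ 3 -ₛ u₂ ^ₛ 3) +ₛ (u₁ ^ₛ 4 -ₛ u₂ ^ₛ 4))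
      ≈⟨ *-congˡ zₛ (≈-sym (+-cong (+-cong (h-def 0) (h-def 2)) (h-def 3))) ⟩
    zₛ *ₛ (h 0 *ₛ Δ +ₛ h 2 *ₛ Δ +ₛ h 3 *ₛ Δ)
      ≈⟨ solve 5 (λ z p q r d → z :* (p :* d :+ q :* d :+ r :* d) := (z :* (p :+ q :+ r)) :* d) (λ _ → refl)
           zₛ (h 0) (h 2) (h 3) Δ ⟩
    (zₛ *ₛ (h 0 +ₛ h 2 +ₛ h 3)) *ₛ Δ ∎)
  h-neighbours (suc m) = *-cancelʳ Δ Δ≢0 (begin
    h (suc (suc m)) *ₛ Δ                   ≈⟨ h-def (suc (suc m)) ⟩
    u₁ *ₛ (u₁ *ₛ x₁) -ₛ u₂ *ₛ (u₂ *ₛ x₂)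
      ≈⟨ solve 4 (λ a b x y → a :* (a :* x) :- b :* (b :* y) := a :^ 2 :* x :- b :^ 2 :* y) (λ _ → refl) u₁ u₂ x₁ x₂ ⟩
    u₁ ^ₛ 2 *ₛ x₁ -ₛ u₂ ^ₛ 2 *ₛ x₂         ≈⟨ +-cong (*-congʳ x₁ root₁) (-‿cong (*-congʳ x₂ root₂)) ⟩
    (zₛ *ₛ Q u₁) *ₛ x₁ -ₛ (zₛ *ₛ Q u₂) *ₛ x₂
      ≈⟨ solve 5 (λ z a b x y → (z :* (a :^ 0 :+ a :+ a :^ 3 :+ a :^ 4)) :* x :- (z :* (b :^ 0 :+ b :+ b :^ 3 :+ b :^ 4)) :* y
           := z :* ((x :- y) :+ (a :* x :- b :* y) :+ (a :* (a :* (a :* x)) :- b :* (b :* (b :* y)))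
                    :+ (a :* (a :* (a :* (a :* x))) :- b :* (b :* (b :* (b :* y)))))) (λ _ → refl) zₛ u₁ u₂ x₁ x₂ ⟩
    zₛ *ₛ ((x₁ -ₛ x₂) +ₛ (u₁ *ₛ x₁ -ₛ u₂ *ₛ x₂) +ₛ (u₁ *ₛ (u₁ *ₛ (u₁ *ₛ x₁)) -ₛ u₂ *ₛ (u₂ *ₛ (u₂ *ₛ x₂)))
           +ₛ (u₁ *ₛ (u₁ *ₛ (u₁ *ₛ (u₁ *ₛ x₁))) -ₛ u₂ *ₛ (u₂ *ₛ (u₂ *ₛ (u₂ *ₛ x₂)))))
      ≈⟨ *-congˡ zₛ (≈-sym (+-cong (+-cong (+-cong (h-def m) (h-def (1 ℕ.+ m))) (h-def (3 ℕ.+ m))) (h-def (4 ℕ.+ m)))) ⟩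
    zₛ *ₛ (h m *ₛ Δ +ₛ h (1 ℕ.+ m) *ₛ Δ +ₛ h (3 ℕ.+ m) *ₛ Δ +ₛ h (4 ℕ.+ m) *ₛ Δ)
      ≈⟨ solve 6 (λ z p q r w d → z :* (p :* d :+ q :* d :+ r :* d :+ w :* d) := (z :* (p :+ q :+ r :+ w)) :* d) (λ _ → refl)
           zₛ (h m) (h (1 ℕ.+ m)) (h (3 ℕ.+ m)) (h (4 ℕ.+ m)) Δ ⟩
    (zₛ *ₛ nbr h (suc (suc m))) *ₛ Δ       ∎)
    where
    x₁ = u₁ ^ₛ suc m
    x₂ = u₂ ^ₛ suc m

  -- π − z π (h₁ + h₂) = −z, from u₂·(root eq. of u₁) − u₁·(root eq. of u₂).
  π-relation : π -ₛ zₛ *ₛ (π *ₛ (h 1 +ₛ h 2)) ≈ -ₛ zₛ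
  π-relation = begin
    π -ₛ zₛ *ₛ (π *ₛ (h 1 +ₛ h 2))                    ≈⟨ +-congʳ (-ₛ (zₛ *ₛ (π *ₛ (h 1 +ₛ h 2)))) π≈ ⟩
    zₛ *ₛ (π *ₛ (h 1 +ₛ h 2) -ₛ 1ₛ) -ₛ zₛ *ₛ (π *ₛ (h 1 +ₛ h 2))
      ≈⟨ solve 3 (λ z x a → z :* (x :- a :^ 0) :- z :* x := :- z) (λ _ → refl) zₛ (π *ₛ (h 1 +ₛ h 2)) u₁ ⟩
    -ₛ zₛ                                             ∎
    where
    π≈ : π ≈ zₛ *ₛ (π *ₛ (h 1 +ₛ h 2) -ₛ 1ₛ)
    π≈ = *-cancelʳ Δ Δ≢0 (begin
      π *ₛ Δ
        ≈⟨ solve 2 (λ a b → (a :* b) :* (a :- b) := b :* a :^ 2 :- a :* b :^ 2) (λ _ → refl) u₁ u₂ ⟩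
      u₂ *ₛ u₁ ^ₛ 2 -ₛ u₁ *ₛ u₂ ^ₛ 2                     ≈⟨ +-cong (*-congˡ u₂ root₁) (-‿cong (*-congˡ u₁ root₂)) ⟩
      u₂ *ₛ (zₛ *ₛ Q u₁) -ₛ u₁ *ₛ (zₛ *ₛ Q u₂)
        ≈⟨ solve 3 (λ z a b → b :* (z :* (a :^ 0 :+ a :+ a :^ 3 :+ a :^ 4)) :- a :* (z :* (b :^ 0 :+ b :+ b :^ 3 :+ b :^ 4))
             := z :* ((a :* b) :* ((a :^ 2 :- b :^ 2) :+ (a :^ 3 :- b :^ 3)) :- (a :- b))) (λ _ → refl) zₛ u₁ u₂ ⟩
      zₛ *ₛ (π *ₛ ((u₁ ^ₛ 2 -ₛ u₂ ^ₛ 2) +ₛ (u₁ ^ₛ 3 -ₛ u₂ ^ₛ 3)) -ₛ Δ)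
        ≈⟨ *-congˡ zₛ (+-congʳ (-ₛ Δ) (*-congˡ π (≈-sym (+-cong (h-def 1) (h-def 2))))) ⟩
      zₛ *ₛ (π *ₛ (h 1 *ₛ Δ +ₛ h 2 *ₛ Δ) -ₛ Δ)
        ≈⟨ solve 5 (λ z p x y d → z :* (p :* (x :* d :+ y :* d) :- d) := (z :* (p :* (x :+ y) :- d :^ 0)) :* d)
             (λ _ → refl) zₛ π (h 1) (h 2) Δ ⟩
      (zₛ *ₛ (π *ₛ (h 1 +ₛ h 2) -ₛ 1ₛ)) *ₛ Δ            ∎)

  -- The symmetric functions of the two roots satisfy σ + π + π σ = 0:
  -- (σ + π + π σ)(π − 1) Δ z = u₂²(z Q(u₁) − u₁²) − u₁²(z Q(u₂) − u₂²) = 0,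
  -- and π − 1 (constant term −1), Δ and z are non-zero.
  σπ-relation : σ +ₛ π +ₛ π *ₛ σ ≈ 0ₛ
  σπ-relation =
    noZeroDivisors _ (π -ₛ 1ₛ) (noZeroDivisors _ Δ (noZeroDivisors _ zₛ product≈0 z≢0) Δ≢0) π-1≢0
    where
    z≢0 : ¬ (zₛ ≈ 0ₛ)
    z≢0 z≈0 with z≈0 2
    ... | ()
    π-1≢0 : ¬ (π -ₛ 1ₛ ≈ 0ₛ)
    π-1≢0 π-1≈0 with trans (sym (cong₂ (λ a b → a ℚ.* b ℚ.+ ℚ.- 1ℚ) u₁₀ u₂₀)) (π-1≈0 0)
    ... | ()
    product≈0 : (((σ +ₛ π +ₛ π *ₛ σ) *ₛ (π -ₛ 1ₛ)) *ₛ Δ) *ₛ zₛ ≈ 0ₛ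
    product≈0 = begin
      (((σ +ₛ π +ₛ π *ₛ σ) *ₛ (π -ₛ 1ₛ)) *ₛ Δ) *ₛ zₛ
        ≈⟨ solve 3 (λ z a b → ((((a :+ b) :+ (a :* b)) :+ (a :* b) :* (a :+ b)) :* ((a :* b) :- a :^ 0) :* (a :- b)) :* z
              := b :^ 2 :* (z :* (a :^ 0 :+ a :+ a :^ 3 :+ a :^ 4) :- a :^ 2) :- a :^ 2 :* (z :* (b :^ 0 :+ b :+ b :^ 3 :+ b :^ 4) :- b :^ 2))
             (λ _ → refl) zₛ u₁ u₂ ⟩
      u₂ ^ₛ 2 *ₛ (zₛ *ₛ Q u₁ -ₛ u₁ ^ₛ 2) -ₛ u₁ ^ₛ 2 *ₛ (zₛ *ₛ Q u₂ -ₛ u₂ ^ₛ 2)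
        ≈⟨ +-cong (*-congˡ (u₂ ^ₛ 2) (≈-trans (difference-zero (≈-sym root₁)) 0ₛ≈const))
                  (-‿cong (*-congˡ (u₁ ^ₛ 2) (≈-trans (difference-zero (≈-sym root₂)) 0ₛ≈const))) ⟩
      u₂ ^ₛ 2 *ₛ constₛ 0ℚ -ₛ u₁ ^ₛ 2 *ₛ constₛ 0ℚ
        ≈⟨ solve 2 (λ a b → b :^ 2 :* con 0ℚ :- a :^ 2 :* con 0ℚ := con 0ℚ) (λ _ → refl) u₁ u₂ ⟩
      constₛ 0ℚ ≈⟨ constₛ-0 ⟩
      0ₛ ∎

  σπ-cancel : ∀ X Y → X -ₛ (σ +ₛ π +ₛ π *ₛ σ) *ₛ Y ≈ X
  σπ-cancel X Y = begin
    X -ₛ (σ +ₛ π +ₛ π *ₛ σ) *ₛ Y  ≈⟨ +-congˡ X (-‿cong (*-congʳ Y (≈-trans σπ-relation 0ₛ≈const))) ⟩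
    X -ₛ constₛ 0ℚ *ₛ Y           ≈⟨ solve 2 (λ x y → x :- con 0ℚ :* y := x) (λ _ → refl) X Y ⟩
    X                             ∎

  S : ℕ → ℕ → Series
  S b k = sumFrom1 (b ⊓ k) (λ i → h (b ∸ i) *ₛ h (k ∸ i))

  S-step : ∀ a k → S (suc a) (suc k) ≈ h a *ₛ h k +ₛ S a k
  S-step a k = sumFrom1-peel (a ⊓ k) (λ i → h (suc a ∸ i) *ₛ h (suc k ∸ i))

  S-zero : ∀ b → S b 0 ≈ 0ₛ
  S-zero zero = ≈-refl
  S-zero (suc b) = ≈-refl

  N : ℕ → ℕ → Series
  N a k = nbr (λ b → S b k) a

  N-zero : ∀ a → N a 0 ≈ 0ₛ
  N-zero a n = nbr-coeff-zero (λ b → S b 0) a n (λ b → S-zero b n)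

  -- Shifting both indices: the neighbours of a+1 are the neighbours of a
  -- shifted by one, except that a+1 = 1 has no neighbour −1.
  N-step : ∀ a k → N (suc a) (suc k) ≈ N a k +ₛ h k *ₛ nbr h a
  N-step zero k = begin
    0ₛ +ₛ S 2 (suc k) +ₛ S 3 (suc k)
      ≈⟨ +-cong (≈-trans (0ₛ-+ (S 2 (suc k))) (S-step 1 k)) (S-step 2 k) ⟩
    (h 1 *ₛ h k +ₛ S 1 k) +ₛ (h 2 *ₛ h k +ₛ S 2 k)
      ≈⟨ solve 5 (λ p q t a b → (p :* t :+ a) :+ (q :* t :+ b) := (a :+ b) :+ t :* (p :+ q)) (λ _ → refl)
           (h 1) (h 2) (h k) (S 1 k) (S 2 k) ⟩
    N zero k +ₛ h k *ₛ nbr h zero ∎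
  N-step (suc zero) k = begin
    0ₛ +ₛ S 1 (suc k) +ₛ S 3 (suc k) +ₛ S 4 (suc k)
      ≈⟨ +-cong (+-cong (≈-trans (0ₛ-+ (S 1 (suc k))) (S-step 0 k)) (S-step 2 k)) (S-step 3 k) ⟩
    (h 0 *ₛ h k +ₛ S 0 k) +ₛ (h 2 *ₛ h k +ₛ S 2 k) +ₛ (h 3 *ₛ h k +ₛ S 3 k)
      ≈⟨ solve 7 (λ p q r t a b c → (p :* t :+ a) :+ (q :* t :+ b) :+ (r :* t :+ c) := (a :+ b :+ c) :+ t :* (p :+ q :+ r))
           (λ _ → refl) (h 0) (h 2) (h 3) (h k) (S 0 k) (S 2 k) (S 3 k) ⟩
    N (suc zero) k +ₛ h k *ₛ nbr h (suc zero) ∎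
  N-step (suc (suc a)) k = begin
    S (1 ℕ.+ a) (suc k) +ₛ S (2 ℕ.+ a) (suc k) +ₛ S (4 ℕ.+ a) (suc k) +ₛ S (5 ℕ.+ a) (suc k)
      ≈⟨ +-cong (+-cong (+-cong (S-step a k) (S-step (1 ℕ.+ a) k)) (S-step (3 ℕ.+ a) k)) (S-step (4 ℕ.+ a) k) ⟩
    (h a *ₛ h k +ₛ S a k) +ₛ (h (1 ℕ.+ a) *ₛ h k +ₛ S (1 ℕ.+ a) k) +ₛ (h (3 ℕ.+ a) *ₛ h k +ₛ S (3 ℕ.+ a) k)
      +ₛ (h (4 ℕ.+ a) *ₛ h k +ₛ S (4 ℕ.+ a) k)
      ≈⟨ solve 9 (λ p q r w t a b c d → (p :* t :+ a) :+ (q :* t :+ b) :+ (r :* t :+ c) :+ (w :* t :+ d)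
                    := (a :+ b :+ c :+ d) :+ t :* (p :+ q :+ r :+ w)) (λ _ → refl)
           (h a) (h (1 ℕ.+ a)) (h (3 ℕ.+ a)) (h (4 ℕ.+ a)) (h k) (S a k) (S (1 ℕ.+ a) k) (S (3 ℕ.+ a) k) (S (4 ℕ.+ a) k) ⟩
    N (suc (suc a)) k +ₛ h k *ₛ nbr h (suc (suc a)) ∎

  candidate : ℕ → ℕ → Series
  candidate k b = (-ₛ π) *ₛ S b k

  candidate-zero : ∀ k → candidate k 0 ≈ 0ₛ
  candidate-zero k = begin
    (-ₛ π) *ₛ 0ₛ         ≈⟨ *-congˡ (-ₛ π) 0ₛ≈const ⟩
    (-ₛ π) *ₛ constₛ 0ℚ  ≈⟨ solve 1 (λ p → (:- p) :* con 0ℚ := con 0ℚ) (λ _ → refl) π ⟩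
    constₛ 0ℚ            ≈⟨ constₛ-0 ⟩
    0ₛ                   ∎

  nbr-candidate : ∀ k a → nbr (candidate k) a ≈ (-ₛ π) *ₛ N a k
  nbr-candidate k zero =
    solve 3 (λ p x y → :- p :* x :+ :- p :* y := :- p :* (x :+ y)) (λ _ → refl) π (S 1 k) (S 2 k)
  nbr-candidate k (suc zero) =
    solve 4 (λ p x y w → :- p :* x :+ :- p :* y :+ :- p :* w := :- p :* (x :+ y :+ w)) (λ _ → refl)
      π (S 0 k) (S 2 k) (S 3 k)
  nbr-candidate k (suc (suc a)) =
    solve 5 (λ p x y w v → :- p :* x :+ :- p :* y :+ :- p :* w :+ :- p :* v := :- p :* (x :+ y :+ w :+ v)) (λ _ → refl)
      π (S a k) (S (1 ℕ.+ a) k) (S (3 ℕ.+ a) k) (S (4 ℕ.+ a) k)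

  defect : ℕ → ℕ → Series
  defect a k = (-ₛ π) *ₛ S a k -ₛ zₛ *ₛ (δₛ a k +ₛ (-ₛ π) *ₛ N a k)

  defect-step : ∀ a k → defect (suc a) (suc k) ≈ defect a k -ₛ π *ₛ (h k *ₛ (h a -ₛ zₛ *ₛ nbr h a))
  defect-step a k = begin
    (-ₛ π) *ₛ S (suc a) (suc k) -ₛ zₛ *ₛ (δₛ a k +ₛ (-ₛ π) *ₛ N (suc a) (suc k))
      ≈⟨ +-cong (*-congˡ (-ₛ π) (S-step a k)) (-‿cong (*-congˡ zₛ (+-congˡ (δₛ a k) (*-congˡ (-ₛ π) (N-step a k))))) ⟩
    (-ₛ π) *ₛ (h a *ₛ h k +ₛ S a k) -ₛ zₛ *ₛ (δₛ a k +ₛ (-ₛ π) *ₛ (N a k +ₛ h k *ₛ nbr h a))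
      ≈⟨ solve 8 (λ p z x t s d n b →
            :- p :* (x :* t :+ s) :- z :* (d :+ :- p :* (n :+ t :* b))
            := (:- p :* s :- z :* (d :+ :- p :* n)) :- p :* (t :* (x :- z :* b)))
          (λ _ → refl) π zₛ (h a) (h k) (S a k) (δₛ a k) (N a k) (nbr h a) ⟩
    defect a k -ₛ π *ₛ (h k *ₛ (h a -ₛ zₛ *ₛ nbr h a)) ∎

  -- At the origin the neighbour sum of the candidate is h; this is where
  -- σ + π + π σ = 0 enters.
  candidate-origin : ∀ k → (-ₛ π) *ₛ (S 1 (suc k) +ₛ S 2 (suc k)) ≈ h (suc k)
  candidate-origin zero = begin
    (-ₛ π) *ₛ ((0ₛ +ₛ h 0 *ₛ h 0) +ₛ (0ₛ +ₛ h 1 *ₛ h 0))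
      ≈⟨ *-congˡ (-ₛ π) (+-cong (≈-trans (0ₛ-+ _) (*ₛ-cong {h 0} {1ₛ} {h 0} {1ₛ} h₀ h₀))
                                 (≈-trans (0ₛ-+ _) (*ₛ-cong {h 1} {σ} {h 0} {1ₛ} h₁ h₀))) ⟩
    (-ₛ π) *ₛ (1ₛ *ₛ 1ₛ +ₛ σ *ₛ 1ₛ)
      ≈⟨ solve 3 (λ s p o → :- p :* (o :^ 0 :* o :^ 0 :+ s :* o :^ 0) := s :- (s :+ p :+ p :* s) :* o :^ 0)
           (λ _ → refl) σ π u₁ ⟩
    σ -ₛ (σ +ₛ π +ₛ π *ₛ σ) *ₛ 1ₛ ≈⟨ σπ-cancel σ 1ₛ ⟩
    σ                              ≈⟨ ≈-sym h₁ ⟩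
    h 1                            ∎
  candidate-origin (suc j) = begin
    (-ₛ π) *ₛ ((0ₛ +ₛ h 0 *ₛ A) +ₛ ((0ₛ +ₛ h 1 *ₛ A) +ₛ h 0 *ₛ B))
      ≈⟨ *-congˡ (-ₛ π) (+-cong (≈-trans (0ₛ-+ _) (*-congʳ A h₀))
                                 (+-cong (≈-trans (0ₛ-+ _) (*-congʳ A h₁)) (*-congʳ B h₀))) ⟩
    (-ₛ π) *ₛ (1ₛ *ₛ A +ₛ (σ *ₛ A +ₛ 1ₛ *ₛ B))
      ≈⟨ solve 4 (λ s p x y → :- p :* (s :^ 0 :* x :+ (s :* x :+ s :^ 0 :* y))
                              := (s :* x :- p :* y) :- (s :+ p :+ p :* s) :* x) (λ _ → refl) σ π A B ⟩
    (σ *ₛ A -ₛ π *ₛ B) -ₛ (σ +ₛ π +ₛ π *ₛ σ) *ₛ A ≈⟨ σπ-cancel _ A ⟩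
    σ *ₛ A -ₛ π *ₛ B                               ≈⟨ ≈-sym (h-rec j) ⟩
    h (suc (suc j))                                ∎
    where
    A = h (suc j)
    B = h j

  defect-origin : ∀ k → defect 0 k ≈ -ₛ (zₛ *ₛ h k)
  defect-origin zero = begin
    (-ₛ π) *ₛ 0ₛ -ₛ zₛ *ₛ (1ₛ +ₛ (-ₛ π) *ₛ (0ₛ +ₛ 0ₛ))
      ≈⟨ +-cong (*-congˡ (-ₛ π) 0ₛ≈const) (-‿cong (*-congˡ zₛ (+-congˡ 1ₛ (*-congˡ (-ₛ π) (+-cong 0ₛ≈const 0ₛ≈const))))) ⟩
    (-ₛ π) *ₛ constₛ 0ℚ -ₛ zₛ *ₛ (1ₛ +ₛ (-ₛ π) *ₛ (constₛ 0ℚ +ₛ constₛ 0ℚ))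
      ≈⟨ solve 2 (λ p z → :- p :* con 0ℚ :- z :* (z :^ 0 :+ :- p :* (con 0ℚ :+ con 0ℚ)) := :- (z :* z :^ 0))
           (λ _ → refl) π zₛ ⟩
    -ₛ (zₛ *ₛ 1ₛ)    ≈⟨ -‿cong (*-congˡ zₛ (≈-sym h₀)) ⟩
    -ₛ (zₛ *ₛ h 0)   ∎
  defect-origin (suc k) = begin
    (-ₛ π) *ₛ 0ₛ -ₛ zₛ *ₛ (0ₛ +ₛ X)
      ≈⟨ +-cong (*-congˡ (-ₛ π) 0ₛ≈const) (-‿cong (*-congˡ zₛ (+-congʳ X 0ₛ≈const))) ⟩
    (-ₛ π) *ₛ constₛ 0ℚ -ₛ zₛ *ₛ (constₛ 0ℚ +ₛ X)
      ≈⟨ solve 3 (λ p z x → :- p :* con 0ℚ :- z :* (con 0ℚ :+ x) := :- (z :* x)) (λ _ → refl) π zₛ X ⟩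
    -ₛ (zₛ *ₛ X)            ≈⟨ -‿cong (*-congˡ zₛ (candidate-origin k)) ⟩
    -ₛ (zₛ *ₛ h (suc k))    ∎
    where
    X = (-ₛ π) *ₛ (S 1 (suc k) +ₛ S 2 (suc k))

  -- Away from the origin the defect vanishes: by defect-step it is
  -- transported from altitude 1 (where π-relation kills it) or target 0.
  defect-vanishes : ∀ a k → defect (suc a) k ≈ 0ₛ
  defect-vanishes a zero = begin
    (-ₛ π) *ₛ 0ₛ -ₛ zₛ *ₛ (0ₛ +ₛ (-ₛ π) *ₛ N (suc a) 0)
      ≈⟨ +-cong (*-congˡ (-ₛ π) 0ₛ≈const)
                (-‿cong (*-congˡ zₛ (+-cong 0ₛ≈const (*-congˡ (-ₛ π) (≈-trans (N-zero (suc a)) 0ₛ≈const))))) ⟩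
    (-ₛ π) *ₛ constₛ 0ℚ -ₛ zₛ *ₛ (constₛ 0ℚ +ₛ (-ₛ π) *ₛ constₛ 0ℚ)
      ≈⟨ solve 2 (λ p z → :- p :* con 0ℚ :- z :* (con 0ℚ :+ :- p :* con 0ℚ) := con 0ℚ) (λ _ → refl) π zₛ ⟩
    constₛ 0ℚ ≈⟨ constₛ-0 ⟩
    0ₛ        ∎
  defect-vanishes zero (suc k) = begin
    defect 1 (suc k)                                                ≈⟨ defect-step 0 k ⟩
    defect 0 k -ₛ π *ₛ (h k *ₛ (h 0 -ₛ zₛ *ₛ (h 1 +ₛ h 2)))
      ≈⟨ +-cong (defect-origin k) (-‿cong (*-congˡ π (*-congˡ (h k) (+-congʳ (-ₛ (zₛ *ₛ (h 1 +ₛ h 2))) h₀)))) ⟩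
    -ₛ (zₛ *ₛ h k) -ₛ π *ₛ (h k *ₛ (1ₛ -ₛ zₛ *ₛ (h 1 +ₛ h 2)))
      ≈⟨ solve 4 (λ p z t w → :- (z :* t) :- p :* (t :* (z :^ 0 :- z :* w)) := :- (z :* t) :- t :* (p :- z :* (p :* w)))
           (λ _ → refl) π zₛ (h k) (h 1 +ₛ h 2) ⟩
    -ₛ (zₛ *ₛ h k) -ₛ h k *ₛ (π -ₛ zₛ *ₛ (π *ₛ (h 1 +ₛ h 2)))      ≈⟨ +-congˡ (-ₛ (zₛ *ₛ h k)) (-‿cong (*-congˡ (h k) π-relation)) ⟩
    -ₛ (zₛ *ₛ h k) -ₛ h k *ₛ (-ₛ zₛ)
      ≈⟨ solve 2 (λ z t → :- (z :* t) :- t :* (:- z) := con 0ℚ) (λ _ → refl) zₛ (h k) ⟩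
    constₛ 0ℚ ≈⟨ constₛ-0 ⟩
    0ₛ        ∎
  defect-vanishes (suc a) (suc k) = begin
    defect (suc (suc a)) (suc k)                                    ≈⟨ defect-step (suc a) k ⟩
    defect (suc a) k -ₛ π *ₛ (h k *ₛ (h (suc a) -ₛ zₛ *ₛ nbr h (suc a)))
      ≈⟨ +-cong (≈-trans (defect-vanishes a k) 0ₛ≈const)
                (-‿cong (*-congˡ π (*-congˡ (h k) (≈-trans (difference-zero (h-neighbours a)) 0ₛ≈const)))) ⟩
    constₛ 0ℚ -ₛ π *ₛ (h k *ₛ constₛ 0ℚ)
      ≈⟨ solve 2 (λ p t → con 0ℚ :- p :* (t :* con 0ℚ) := con 0ℚ) (λ _ → refl) π (h k) ⟩
    constₛ 0ℚ ≈⟨ constₛ-0 ⟩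
    0ₛ        ∎

  candidate-solves : ∀ k → SolvesSystem k (candidate k)
  candidate-solves k a =
    ≈-trans (difference-zero⁻¹ (defect-vanishes a k))
            (*-congˡ zₛ (+-congˡ (δₛ (suc a) k) (≈-sym (nbr-candidate k (suc a)))))

mainTheorem6 : (u₁ u₂ : Series)
    → u₁ 0 ≡ 0ℚ → u₂ 0 ≡ 0ℚ
    → IsRoot u₁ → IsRoot u₂
    → ¬ (u₁ ≈ 0ₛ) → ¬ (u₂ ≈ 0ₛ) → ¬ (u₁ ≈ u₂)
    → (h : ℕ → Series)
    → (∀ m → h m *ₛ (u₁ -ₛ u₂) ≈ u₁ ^ₛ suc m -ₛ u₂ ^ₛ suc m)
    → (∀ k → 0 < k → G 0 k ≈ h k)
      × (∀ j k → 0 < j → 0 < k →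
           zₛ *ₛ G j k ≈ (-ₛ (u₁ *ₛ u₂)) *ₛ sumFrom1 (j ⊓ k) (λ i → h (j ∸ i) *ₛ h (k ∸ i)))
mainTheorem6 u₁ u₂ u₁₀ u₂₀ root₁ root₂ _ _ u₁≢u₂ h h-def = G-from-origin , G-interior
  where
  open Roots u₁ u₂ u₁₀ u₂₀ root₁ root₂ u₁≢u₂ h h-def
  open ≈-Reasoning

  firstPassage≈candidate : ∀ k b → firstPassage (suc k) b ≈ candidate (suc k) b
  firstPassage≈candidate k = system-unique (suc k) (firstPassage (suc k)) (candidate (suc k))
    (≈-sym (candidate-zero (suc k))) (firstPassage-solves k) (candidate-solves (suc k))

  G-from-origin : ∀ k → 0 < k → G 0 k ≈ h k
  G-from-origin (suc k) _ = begin
    G 0 (suc k)                                              ≈⟨ G-firstStep k 0 ⟩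
    0ₛ +ₛ (firstPassage (suc k) 1 +ₛ firstPassage (suc k) 2) ≈⟨ 0ₛ-+ _ ⟩
    firstPassage (suc k) 1 +ₛ firstPassage (suc k) 2
      ≈⟨ +-cong (firstPassage≈candidate k 1) (firstPassage≈candidate k 2) ⟩
    nbr (candidate (suc k)) 0                                ≈⟨ nbr-candidate (suc k) 0 ⟩
    (-ₛ π) *ₛ (S 1 (suc k) +ₛ S 2 (suc k))                   ≈⟨ candidate-origin k ⟩
    h (suc k)                                                ∎

  G-interior : ∀ j k → 0 < j → 0 < k →
    zₛ *ₛ G j k ≈ (-ₛ (u₁ *ₛ u₂)) *ₛ sumFrom1 (j ⊓ k) (λ i → h (j ∸ i) *ₛ h (k ∸ i))
  G-interior (suc a) (suc k) _ _ = firstPassage≈candidate k (suc a)
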